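{- For all arithmetical formulas $\varphi_0,\varphi_1\in\Sigma_2$ there is $\varphi\in\Sigma_2$ such that $\mathrm{HA}\vdash\varphi_0\vee\varphi_1\leftrightarrow\varphi$.
   Context: $\mathrm{HA}$ is Heyting Arithmetic. $\Delta_0$ formulas are those with only bounded quantifiers, $\Sigma_0=\Pi_0=\Delta_0$, $\Sigma_{n+1}$ formulas are existential quantifications of $\Pi_n$ formulas and $\Pi_{n+1}$ formulas are universal quantifications of $\Sigma_n$ formulas. -}

module Defs where

open import Data.Nat using (ℕ; zero; suc)
open import Data.Fin using (Fin; zero; suc)
open import Data.List using (List; []; _∷_; map)
open import Data.List.Membership.Propositional using (_∈_)
open import Data.Product using (_×_)

infixl 7 _⊗_
infixl 6 _⊕_
infix 4 _≐_
infixr 3 _∧'_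
infixr 2 _∨'_
infixr 1 _⇒_ _⇔_

data Tm (n : ℕ) : Set where
  var : Fin n → Tm n
  𝟎   : Tm n
  S   : Tm n → Tm n
  _⊕_ : Tm n → Tm n → Tm n
  _⊗_ : Tm n → Tm n → Tm n

data Fm (n : ℕ) : Set where
  ⊥'   : Fm n
  _≐_  : Tm n → Tm n → Fm n
  _∧'_ : Fm n → Fm n → Fm n
  _∨'_ : Fm n → Fm n → Fm n
  _⇒_  : Fm n → Fm n → Fm n
  ∀'   : Fm (suc n) → Fm n
  ∃'   : Fm (suc n) → Fm n

¬' : ∀ {n} → Fm n → Fm n
¬' φ = φ ⇒ ⊥'

_⇔_ : ∀ {n} → Fm n → Fm n → Fm n
φ ⇔ ψ = (φ ⇒ ψ) ∧' (ψ ⇒ φ)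

Ren : ℕ → ℕ → Set
Ren n m = Fin n → Fin m

liftR : ∀ {n m} → Ren n m → Ren (suc n) (suc m)
liftR ρ zero    = zero
liftR ρ (suc i) = suc (ρ i)

renT : ∀ {n m} → Ren n m → Tm n → Tm m
renT ρ (var i) = var (ρ i)
renT ρ 𝟎       = 𝟎
renT ρ (S t)   = S (renT ρ t)
renT ρ (t ⊕ u) = renT ρ t ⊕ renT ρ u
renT ρ (t ⊗ u) = renT ρ t ⊗ renT ρ u

renF : ∀ {n m} → Ren n m → Fm n → Fm m
renF ρ ⊥'       = ⊥'
renF ρ (t ≐ u)  = renT ρ t ≐ renT ρ u
renF ρ (φ ∧' ψ) = renF ρ φ ∧' renF ρ ψ
renF ρ (φ ∨' ψ) = renF ρ φ ∨' renF ρ ψ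
renF ρ (φ ⇒ ψ)  = renF ρ φ ⇒ renF ρ ψ
renF ρ (∀' φ)   = ∀' (renF (liftR ρ) φ)
renF ρ (∃' φ)   = ∃' (renF (liftR ρ) φ)

wkT : ∀ {n} → Tm n → Tm (suc n)
wkT = renT suc

wkF : ∀ {n} → Fm n → Fm (suc n)
wkF = renF suc

Sub : ℕ → ℕ → Set
Sub n m = Fin n → Tm m

liftS : ∀ {n m} → Sub n m → Sub (suc n) (suc m)
liftS σ zero    = var zero
liftS σ (suc i) = wkT (σ i)

subT : ∀ {n m} → Sub n m → Tm n → Tm m
subT σ (var i) = σ i
subT σ 𝟎       = 𝟎
subT σ (S t)   = S (subT σ t)
subT σ (t ⊕ u) = subT σ t ⊕ subT σ u
subT σ (t ⊗ u) = subT σ t ⊗ subT σ u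

subF : ∀ {n m} → Sub n m → Fm n → Fm m
subF σ ⊥'       = ⊥'
subF σ (t ≐ u)  = subT σ t ≐ subT σ u
subF σ (φ ∧' ψ) = subF σ φ ∧' subF σ ψ
subF σ (φ ∨' ψ) = subF σ φ ∨' subF σ ψ
subF σ (φ ⇒ ψ)  = subF σ φ ⇒ subF σ ψ
subF σ (∀' φ)   = ∀' (subF (liftS σ) φ)
subF σ (∃' φ)   = ∃' (subF (liftS σ) φ)

sub0 : ∀ {n} → Tm n → Sub (suc n) n
sub0 t zero    = t
sub0 t (suc i) = var i

_[_] : ∀ {n} → Fm (suc n) → Tm n → Fm n
φ [ t ] = subF (sub0 t) φ

succSub : ∀ {n} → Sub (suc n) (suc n)
succSub zero    = S (var zero)
succSub (suc i) = var (suc i)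

_<'_ : ∀ {n} → Tm n → Tm n → Fm n
t <' u = ∃' (wkT t ⊕ S (var zero) ≐ wkT u)

-- ∀x<t φ  :=  ∀x (x < t → φ)      (x = variable 0 of φ, not free in t)
∀<' : ∀ {n} → Tm n → Fm (suc n) → Fm n
∀<' t φ = ∀' ((var zero <' wkT t) ⇒ φ)

∃<' : ∀ {n} → Tm n → Fm (suc n) → Fm n
∃<' t φ = ∃' ((var zero <' wkT t) ∧' φ)

data IsΔ₀ {n : ℕ} : Fm n → Set where
  ⊥-Δ₀ : IsΔ₀ ⊥'
  ≐-Δ₀ : ∀ t u → IsΔ₀ (t ≐ u)
  ∧-Δ₀ : ∀ {φ ψ} → IsΔ₀ φ → IsΔ₀ ψ → IsΔ₀ (φ ∧' ψ)
  ∨-Δ₀ : ∀ {φ ψ} → IsΔ₀ φ → IsΔ₀ ψ → IsΔ₀ (φ ∨' ψ)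
  ⇒-Δ₀ : ∀ {φ ψ} → IsΔ₀ φ → IsΔ₀ ψ → IsΔ₀ (φ ⇒ ψ)
  ∀<-Δ₀ : ∀ t {φ} → IsΔ₀ φ → IsΔ₀ (∀<' t φ)
  ∃<-Δ₀ : ∀ t {φ} → IsΔ₀ φ → IsΔ₀ (∃<' t φ)

-- Σ_{k+1}: a (possibly empty) block of existential quantifiers in front
-- of a Π_k formula; Π_{k+1} dually.  Σ_0 = Π_0 = Δ_0.
mutual
  IsΣ : ℕ → ∀ {n} → Fm n → Set
  IsΣ zero    φ = IsΔ₀ φ
  IsΣ (suc k) φ = IsΣ⁺ k φ

  IsΠ : ℕ → ∀ {n} → Fm n → Set
  IsΠ zero    φ = IsΔ₀ φ
  IsΠ (suc k) φ = IsΠ⁺ k φ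

  data IsΣ⁺ (k : ℕ) {n : ℕ} : Fm n → Set where
    base : ∀ {φ} → IsΠ k φ → IsΣ⁺ k φ
    ex   : ∀ {φ : Fm (suc n)} → IsΣ⁺ k φ → IsΣ⁺ k (∃' φ)

  data IsΠ⁺ (k : ℕ) {n : ℕ} : Fm n → Set where
    base : ∀ {φ} → IsΣ k φ → IsΠ⁺ k φ
    all  : ∀ {φ : Fm (suc n)} → IsΠ⁺ k φ → IsΠ⁺ k (∀' φ)

infix 0 _⊢_

data _⊢_ {n : ℕ} (Γ : List (Fm n)) : Fm n → Set where
  hyp   : ∀ {φ} → φ ∈ Γ → Γ ⊢ φ
  ⊥E    : ∀ {φ} → Γ ⊢ ⊥' → Γ ⊢ φ
  ∧I    : ∀ {φ ψ} → Γ ⊢ φ → Γ ⊢ ψ → Γ ⊢ φ ∧' ψ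
  ∧E₁   : ∀ {φ ψ} → Γ ⊢ φ ∧' ψ → Γ ⊢ φ
  ∧E₂   : ∀ {φ ψ} → Γ ⊢ φ ∧' ψ → Γ ⊢ ψ
  ∨I₁   : ∀ {φ ψ} → Γ ⊢ φ → Γ ⊢ φ ∨' ψ
  ∨I₂   : ∀ {φ ψ} → Γ ⊢ ψ → Γ ⊢ φ ∨' ψ
  ∨E    : ∀ {φ ψ χ} → Γ ⊢ φ ∨' ψ → (φ ∷ Γ) ⊢ χ → (ψ ∷ Γ) ⊢ χ → Γ ⊢ χ
  ⇒I    : ∀ {φ ψ} → (φ ∷ Γ) ⊢ ψ → Γ ⊢ φ ⇒ ψ
  ⇒E    : ∀ {φ ψ} → Γ ⊢ φ ⇒ ψ → Γ ⊢ φ → Γ ⊢ ψ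
  ∀I    : ∀ {φ : Fm (suc n)} → map wkF Γ ⊢ φ → Γ ⊢ ∀' φ
  ∀E    : ∀ {φ : Fm (suc n)} (t : Tm n) → Γ ⊢ ∀' φ → Γ ⊢ φ [ t ]
  ∃I    : ∀ {φ : Fm (suc n)} (t : Tm n) → Γ ⊢ φ [ t ] → Γ ⊢ ∃' φ
  ∃E    : ∀ {φ : Fm (suc n)} {ψ} → Γ ⊢ ∃' φ → (φ ∷ map wkF Γ) ⊢ wkF ψ → Γ ⊢ ψ
  ≐refl : ∀ t → Γ ⊢ t ≐ t
  ≐subst : ∀ (φ : Fm (suc n)) {t u} → Γ ⊢ t ≐ u → Γ ⊢ φ [ t ] → Γ ⊢ φ [ u ]
  S≢0   : ∀ t → Γ ⊢ ¬' (S t ≐ 𝟎)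
  S-inj : ∀ t u → Γ ⊢ S t ≐ S u ⇒ t ≐ u
  +0    : ∀ t → Γ ⊢ t ⊕ 𝟎 ≐ t
  +S    : ∀ t u → Γ ⊢ t ⊕ S u ≐ S (t ⊕ u)
  *0    : ∀ t → Γ ⊢ t ⊗ 𝟎 ≐ 𝟎
  *S    : ∀ t u → Γ ⊢ t ⊗ S u ≐ (t ⊗ u) ⊕ t
  ind   : ∀ (φ : Fm (suc n)) →
          Γ ⊢ φ [ 𝟎 ] → Γ ⊢ ∀' (φ ⇒ subF succSub φ) → Γ ⊢ ∀' φ

HA⊢ : ∀ {n} → Fm n → Set
HA⊢ φ = [] ⊢ φ

{-# OPTIONS --safe #-}
-- An existential prefix can be pulled out of a disjunction, so it suffices to
-- treat a disjunction A ∨ B of Π₁ formulas.  It is equivalent to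
--   ∃x ((x = 0 → A) ∧ (x = 1 → B) ∧ (x = 0 ∨ x = 1)),
-- and universal quantifiers can be pulled out of Δ₀ → Π₁ and of Π₁ ∧ Π₁, so the
-- matrix is equivalent to a Π₁ formula.
module Submission where

open import Defs
open import Data.Nat using (ℕ; zero; suc)
open import Data.Product using (Σ-syntax; _×_; _,_)
open import Data.Fin using (Fin; zero; suc)
open import Data.List using (List; []; _∷_)
open import Data.List.Relation.Unary.Any using (here; there)
open import Data.List.Relation.Binary.Subset.Propositional using (_⊆_)
open import Data.List.Relation.Binary.Subset.Propositional.Properties using (map⁺; ∷⁺ʳ)
open import Relation.Binary.PropositionalEquality using (_≡_; refl; sym; trans; cong; cong₂; subst)
open import Function using (_∘_)

renT-∘ : ∀ {k m l} (ρ : Ren m l) (ρ′ : Ren k m) t → renT ρ (renT ρ′ t) ≡ renT (ρ ∘ ρ′) t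
renT-∘ ρ ρ′ (var i) = refl
renT-∘ ρ ρ′ 𝟎       = refl
renT-∘ ρ ρ′ (S t)   = cong S (renT-∘ ρ ρ′ t)
renT-∘ ρ ρ′ (t ⊕ u) = cong₂ _⊕_ (renT-∘ ρ ρ′ t) (renT-∘ ρ ρ′ u)
renT-∘ ρ ρ′ (t ⊗ u) = cong₂ _⊗_ (renT-∘ ρ ρ′ t) (renT-∘ ρ ρ′ u)

renT-liftR-wkT : ∀ {n m} (ρ : Ren n m) t → renT (liftR ρ) (wkT t) ≡ wkT (renT ρ t)
renT-liftR-wkT ρ t = trans (renT-∘ (liftR ρ) suc t) (sym (renT-∘ suc ρ t))

subT-cong : ∀ {n m} {σ σ′ : Sub n m} → (∀ i → σ i ≡ σ′ i) → ∀ t → subT σ t ≡ subT σ′ t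
subT-cong eq (var i) = eq i
subT-cong eq 𝟎       = refl
subT-cong eq (S t)   = cong S (subT-cong eq t)
subT-cong eq (t ⊕ u) = cong₂ _⊕_ (subT-cong eq t) (subT-cong eq u)
subT-cong eq (t ⊗ u) = cong₂ _⊗_ (subT-cong eq t) (subT-cong eq u)

liftS-cong : ∀ {n m} {σ σ′ : Sub n m} → (∀ i → σ i ≡ σ′ i) → ∀ i → liftS σ i ≡ liftS σ′ i
liftS-cong eq zero    = refl
liftS-cong eq (suc i) = cong wkT (eq i)

subF-cong : ∀ {n m} {σ σ′ : Sub n m} → (∀ i → σ i ≡ σ′ i) → ∀ φ → subF σ φ ≡ subF σ′ φ
subF-cong eq ⊥'       = refl
subF-cong eq (t ≐ u)  = cong₂ _≐_ (subT-cong eq t) (subT-cong eq u)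
subF-cong eq (φ ∧' ψ) = cong₂ _∧'_ (subF-cong eq φ) (subF-cong eq ψ)
subF-cong eq (φ ∨' ψ) = cong₂ _∨'_ (subF-cong eq φ) (subF-cong eq ψ)
subF-cong eq (φ ⇒ ψ)  = cong₂ _⇒_ (subF-cong eq φ) (subF-cong eq ψ)
subF-cong eq (∀' φ)   = cong ∀' (subF-cong (liftS-cong eq) φ)
subF-cong eq (∃' φ)   = cong ∃' (subF-cong (liftS-cong eq) φ)

subT-renT : ∀ {k m l} (σ : Sub m l) (ρ : Ren k m) t → subT σ (renT ρ t) ≡ subT (σ ∘ ρ) t
subT-renT σ ρ (var i) = refl
subT-renT σ ρ 𝟎       = refl
subT-renT σ ρ (S t)   = cong S (subT-renT σ ρ t)
subT-renT σ ρ (t ⊕ u) = cong₂ _⊕_ (subT-renT σ ρ t) (subT-renT σ ρ u)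
subT-renT σ ρ (t ⊗ u) = cong₂ _⊗_ (subT-renT σ ρ t) (subT-renT σ ρ u)

liftS-liftR : ∀ {k m l} (σ : Sub m l) (ρ : Ren k m) i → liftS σ (liftR ρ i) ≡ liftS (σ ∘ ρ) i
liftS-liftR σ ρ zero    = refl
liftS-liftR σ ρ (suc i) = refl

subF-renF : ∀ {k m l} (σ : Sub m l) (ρ : Ren k m) φ → subF σ (renF ρ φ) ≡ subF (σ ∘ ρ) φ
subF-renF σ ρ ⊥'       = refl
subF-renF σ ρ (t ≐ u)  = cong₂ _≐_ (subT-renT σ ρ t) (subT-renT σ ρ u)
subF-renF σ ρ (φ ∧' ψ) = cong₂ _∧'_ (subF-renF σ ρ φ) (subF-renF σ ρ ψ)
subF-renF σ ρ (φ ∨' ψ) = cong₂ _∨'_ (subF-renF σ ρ φ) (subF-renF σ ρ ψ)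
subF-renF σ ρ (φ ⇒ ψ)  = cong₂ _⇒_ (subF-renF σ ρ φ) (subF-renF σ ρ ψ)
subF-renF σ ρ (∀' φ)   =
  cong ∀' (trans (subF-renF (liftS σ) (liftR ρ) φ) (subF-cong (liftS-liftR σ ρ) φ))
subF-renF σ ρ (∃' φ)   =
  cong ∃' (trans (subF-renF (liftS σ) (liftR ρ) φ) (subF-cong (liftS-liftR σ ρ) φ))

subT-id : ∀ {n} {σ : Sub n n} → (∀ i → σ i ≡ var i) → ∀ t → subT σ t ≡ t
subT-id eq (var i) = eq i
subT-id eq 𝟎       = refl
subT-id eq (S t)   = cong S (subT-id eq t)
subT-id eq (t ⊕ u) = cong₂ _⊕_ (subT-id eq t) (subT-id eq u)
subT-id eq (t ⊗ u) = cong₂ _⊗_ (subT-id eq t) (subT-id eq u)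

liftS-id : ∀ {n} {σ : Sub n n} → (∀ i → σ i ≡ var i) → ∀ i → liftS σ i ≡ var i
liftS-id eq zero    = refl
liftS-id eq (suc i) = cong wkT (eq i)

subF-id : ∀ {n} {σ : Sub n n} → (∀ i → σ i ≡ var i) → ∀ φ → subF σ φ ≡ φ
subF-id eq ⊥'       = refl
subF-id eq (t ≐ u)  = cong₂ _≐_ (subT-id eq t) (subT-id eq u)
subF-id eq (φ ∧' ψ) = cong₂ _∧'_ (subF-id eq φ) (subF-id eq ψ)
subF-id eq (φ ∨' ψ) = cong₂ _∨'_ (subF-id eq φ) (subF-id eq ψ)
subF-id eq (φ ⇒ ψ)  = cong₂ _⇒_ (subF-id eq φ) (subF-id eq ψ)
subF-id eq (∀' φ)   = cong ∀' (subF-id (liftS-id eq) φ)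
subF-id eq (∃' φ)   = cong ∃' (subF-id (liftS-id eq) φ)

wkF-[] : ∀ {n} (φ : Fm n) t → wkF φ [ t ] ≡ φ
wkF-[] φ t = trans (subF-renF (sub0 t) suc φ) (subF-id (λ _ → refl) φ)

renF-liftR-suc-[x₀] : ∀ {n} (φ : Fm (suc n)) → renF (liftR suc) φ [ var zero ] ≡ φ
renF-liftR-suc-[x₀] φ =
  trans (subF-renF (sub0 (var zero)) (liftR suc) φ) (subF-id sub0-x₀∘liftR-suc φ)
  where
  sub0-x₀∘liftR-suc : ∀ {n} (i : Fin (suc n)) → sub0 (var zero) (liftR suc i) ≡ var i
  sub0-x₀∘liftR-suc zero    = refl
  sub0-x₀∘liftR-suc (suc i) = refl

renF-Δ₀ : ∀ {n m} (ρ : Ren n m) {φ : Fm n} → IsΔ₀ φ → IsΔ₀ (renF ρ φ)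
renF-Δ₀ ρ ⊥-Δ₀        = ⊥-Δ₀
renF-Δ₀ ρ (≐-Δ₀ t u)  = ≐-Δ₀ _ _
renF-Δ₀ ρ (∧-Δ₀ p q)  = ∧-Δ₀ (renF-Δ₀ ρ p) (renF-Δ₀ ρ q)
renF-Δ₀ ρ (∨-Δ₀ p q)  = ∨-Δ₀ (renF-Δ₀ ρ p) (renF-Δ₀ ρ q)
renF-Δ₀ ρ (⇒-Δ₀ p q)  = ⇒-Δ₀ (renF-Δ₀ ρ p) (renF-Δ₀ ρ q)
renF-Δ₀ ρ (∀<-Δ₀ t p) rewrite renT-liftR-wkT (liftR ρ) (wkT t) | renT-liftR-wkT ρ t =
  ∀<-Δ₀ (renT ρ t) (renF-Δ₀ (liftR ρ) p)
renF-Δ₀ ρ (∃<-Δ₀ t p) rewrite renT-liftR-wkT (liftR ρ) (wkT t) | renT-liftR-wkT ρ t =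
  ∃<-Δ₀ (renT ρ t) (renF-Δ₀ (liftR ρ) p)

mutual
  renF-Σ : ∀ k {n m} (ρ : Ren n m) {φ : Fm n} → IsΣ k φ → IsΣ k (renF ρ φ)
  renF-Σ zero    = renF-Δ₀
  renF-Σ (suc k) = renF-Σ⁺ k

  renF-Π : ∀ k {n m} (ρ : Ren n m) {φ : Fm n} → IsΠ k φ → IsΠ k (renF ρ φ)
  renF-Π zero    = renF-Δ₀
  renF-Π (suc k) = renF-Π⁺ k

  renF-Σ⁺ : ∀ k {n m} (ρ : Ren n m) {φ : Fm n} → IsΣ⁺ k φ → IsΣ⁺ k (renF ρ φ)
  renF-Σ⁺ k ρ (base p) = base (renF-Π k ρ p)
  renF-Σ⁺ k ρ (ex p)   = ex (renF-Σ⁺ k (liftR ρ) p)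

  renF-Π⁺ : ∀ k {n m} (ρ : Ren n m) {φ : Fm n} → IsΠ⁺ k φ → IsΠ⁺ k (renF ρ φ)
  renF-Π⁺ k ρ (base p) = base (renF-Σ k ρ p)
  renF-Π⁺ k ρ (all p)  = all (renF-Π⁺ k (liftR ρ) p)

weaken : ∀ {n} {Γ Δ : List (Fm n)} {φ} → Γ ⊆ Δ → Γ ⊢ φ → Δ ⊢ φ
weaken s (hyp x)        = hyp (s x)
weaken s (⊥E d)         = ⊥E (weaken s d)
weaken s (∧I d e)       = ∧I (weaken s d) (weaken s e)
weaken s (∧E₁ d)        = ∧E₁ (weaken s d)
weaken s (∧E₂ d)        = ∧E₂ (weaken s d)
weaken s (∨I₁ d)        = ∨I₁ (weaken s d)
weaken s (∨I₂ d)        = ∨I₂ (weaken s d)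
weaken s (∨E d e f)     = ∨E (weaken s d) (weaken (∷⁺ʳ _ s) e) (weaken (∷⁺ʳ _ s) f)
weaken s (⇒I d)         = ⇒I (weaken (∷⁺ʳ _ s) d)
weaken s (⇒E d e)       = ⇒E (weaken s d) (weaken s e)
weaken s (∀I d)         = ∀I (weaken (map⁺ wkF s) d)
weaken s (∀E t d)       = ∀E t (weaken s d)
weaken s (∃I t d)       = ∃I t (weaken s d)
weaken s (∃E d e)       = ∃E (weaken s d) (weaken (∷⁺ʳ _ (map⁺ wkF s)) e)
weaken s (≐refl t)      = ≐refl t
weaken s (≐subst φ d e) = ≐subst φ (weaken s d) (weaken s e)
weaken s (S≢0 t)        = S≢0 t
weaken s (S-inj t u)    = S-inj t u
weaken s (+0 t)         = +0 t
weaken s (+S t u)       = +S t u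
weaken s (*0 t)         = *0 t
weaken s (*S t u)       = *S t u
weaken s (ind φ d e)    = ind φ (weaken s d) (weaken s e)

fromHA : ∀ {n} {Γ : List (Fm n)} {φ} → HA⊢ φ → Γ ⊢ φ
fromHA = weaken (λ ())

hyp₀ : ∀ {n} {Γ : List (Fm n)} {A} → (A ∷ Γ) ⊢ A
hyp₀ = hyp (here refl)

hyp₁ : ∀ {n} {Γ : List (Fm n)} {A B} → (B ∷ A ∷ Γ) ⊢ A
hyp₁ = hyp (there (here refl))

0≢1 : ∀ {n} {Γ : List (Fm n)} → Γ ⊢ 𝟎 ≐ S 𝟎 → Γ ⊢ ⊥'
0≢1 0≐1 = ⇒E (S≢0 𝟎) (≐subst (var zero ≐ 𝟎) 0≐1 (≐refl 𝟎))

cast : ∀ {n} {Γ : List (Fm n)} {A B} → A ≡ B → Γ ⊢ A → Γ ⊢ B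
cast {Γ = Γ} = subst (Γ ⊢_)

∀E-x₀ : ∀ {n} {Γ : List (Fm (suc n))} {φ : Fm (suc n)} → Γ ⊢ wkF (∀' φ) → Γ ⊢ φ
∀E-x₀ {φ = φ} d = cast (renF-liftR-suc-[x₀] φ) (∀E (var zero) d)

∃I-x₀ : ∀ {n} {Γ : List (Fm (suc n))} {φ : Fm (suc n)} → Γ ⊢ φ → Γ ⊢ wkF (∃' φ)
∃I-x₀ {φ = φ} d = ∃I (var zero) (cast (sym (renF-liftR-suc-[x₀] φ)) d)

⇔-intro : ∀ {n} {A B : Fm n} → (A ∷ []) ⊢ B → (B ∷ []) ⊢ A → HA⊢ (A ⇔ B)
⇔-intro f g = ∧I (⇒I f) (⇒I g)

⇔-to : ∀ {n} {Γ : List (Fm n)} {A B} → HA⊢ (A ⇔ B) → Γ ⊢ A → Γ ⊢ B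
⇔-to e = ⇒E (fromHA (∧E₁ e))

⇔-from : ∀ {n} {Γ : List (Fm n)} {A B} → HA⊢ (A ⇔ B) → Γ ⊢ B → Γ ⊢ A
⇔-from e = ⇒E (fromHA (∧E₂ e))

⇔-refl : ∀ {n} {A : Fm n} → HA⊢ (A ⇔ A)
⇔-refl = ⇔-intro hyp₀ hyp₀

⇔-trans : ∀ {n} {A B C : Fm n} → HA⊢ (A ⇔ B) → HA⊢ (B ⇔ C) → HA⊢ (A ⇔ C)
⇔-trans e f = ⇔-intro (⇔-to f (⇔-to e hyp₀)) (⇔-from e (⇔-from f hyp₀))

∧-cong : ∀ {n} {A A′ B B′ : Fm n} →
         HA⊢ (A ⇔ A′) → HA⊢ (B ⇔ B′) → HA⊢ ((A ∧' B) ⇔ (A′ ∧' B′))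
∧-cong e f = ⇔-intro (∧I (⇔-to e (∧E₁ hyp₀)) (⇔-to f (∧E₂ hyp₀)))
                     (∧I (⇔-from e (∧E₁ hyp₀)) (⇔-from f (∧E₂ hyp₀)))

∃-cong : ∀ {n} {A B : Fm (suc n)} → HA⊢ (A ⇔ B) → HA⊢ (∃' A ⇔ ∃' B)
∃-cong e = ⇔-intro (∃E hyp₀ (∃I-x₀ (⇔-to e hyp₀))) (∃E hyp₀ (∃I-x₀ (⇔-from e hyp₀)))

∀-cong : ∀ {n} {A B : Fm (suc n)} → HA⊢ (A ⇔ B) → HA⊢ (∀' A ⇔ ∀' B)
∀-cong e = ⇔-intro (∀I (⇔-to e (∀E-x₀ hyp₀))) (∀I (⇔-from e (∀E-x₀ hyp₀)))

EquivalentIn : ∀ {n} → (Fm n → Set) → Fm n → Set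
EquivalentIn {n} C φ = Σ[ ψ ∈ Fm n ] (C ψ × HA⊢ (φ ⇔ ψ))

equivalentIn-self : ∀ {n} {C : Fm n → Set} {φ} → C φ → EquivalentIn C φ
equivalentIn-self {φ = φ} c = φ , c , ⇔-refl

equivalentIn-⇔ : ∀ {n} {C : Fm n → Set} {φ ψ} →
                 HA⊢ (φ ⇔ ψ) → EquivalentIn C ψ → EquivalentIn C φ
equivalentIn-⇔ e (χ , c , f) = χ , c , ⇔-trans e f

equivalentIn-mono : ∀ {n} {C D : Fm n → Set} {φ} →
                    (∀ {ψ} → C ψ → D ψ) → EquivalentIn C φ → EquivalentIn D φ
equivalentIn-mono C⊆D (ψ , c , e) = ψ , C⊆D c , e

∀-equivalentIn : ∀ {k n} {φ : Fm (suc n)} →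
                 EquivalentIn (IsΠ⁺ k) φ → EquivalentIn (IsΠ⁺ k) (∀' φ)
∀-equivalentIn (ψ , c , e) = ∀' ψ , all c , ∀-cong e

∃-equivalentIn : ∀ {k n} {φ : Fm (suc n)} →
                 EquivalentIn (IsΣ⁺ k) φ → EquivalentIn (IsΣ⁺ k) (∃' φ)
∃-equivalentIn (ψ , c , e) = ∃' ψ , ex c , ∃-cong e

∀-pull-⇒ʳ : ∀ {n} (D : Fm n) (α : Fm (suc n)) → HA⊢ ((D ⇒ ∀' α) ⇔ ∀' (wkF D ⇒ α))
∀-pull-⇒ʳ D α =
  ⇔-intro (∀I (⇒I (∀E-x₀ (⇒E hyp₁ hyp₀))))
          (⇒I (∀I (⇒E (∀E-x₀ hyp₁) hyp₀)))

∀-pull-∧ˡ : ∀ {n} (α : Fm (suc n)) (B : Fm n) → HA⊢ ((∀' α ∧' B) ⇔ ∀' (α ∧' wkF B))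
∀-pull-∧ˡ α B =
  ⇔-intro (∀I (∧I (∀E-x₀ (∧E₁ hyp₀)) (∧E₂ hyp₀)))
          (∧I (∀I (∧E₁ (∀E-x₀ hyp₀))) (cast (wkF-[] B 𝟎) (∧E₂ (∀E 𝟎 hyp₀))))

∀-pull-∧ʳ : ∀ {n} (A : Fm n) (β : Fm (suc n)) → HA⊢ ((A ∧' ∀' β) ⇔ ∀' (wkF A ∧' β))
∀-pull-∧ʳ A β =
  ⇔-intro (∀I (∧I (∧E₁ hyp₀) (∀E-x₀ (∧E₂ hyp₀))))
          (∧I (cast (wkF-[] A 𝟎) (∧E₁ (∀E 𝟎 hyp₀))) (∀I (∧E₂ (∀E-x₀ hyp₀))))

∃-pull-∨ˡ : ∀ {n} (α : Fm (suc n)) (B : Fm n) → HA⊢ ((∃' α ∨' B) ⇔ ∃' (α ∨' wkF B))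
∃-pull-∨ˡ α B =
  ⇔-intro (∨E hyp₀ (∃E hyp₀ (∃I-x₀ (∨I₁ hyp₀)))
                   (∃I 𝟎 (∨I₂ (cast (sym (wkF-[] B 𝟎)) hyp₀))))
          (∃E hyp₀ (∨E hyp₀ (∨I₁ (∃I-x₀ hyp₀)) (∨I₂ hyp₀)))

∃-pull-∨ʳ : ∀ {n} (A : Fm n) (β : Fm (suc n)) → HA⊢ ((A ∨' ∃' β) ⇔ ∃' (wkF A ∨' β))
∃-pull-∨ʳ A β =
  ⇔-intro (∨E hyp₀ (∃I 𝟎 (∨I₁ (cast (sym (wkF-[] A 𝟎)) hyp₀)))
                   (∃E hyp₀ (∃I-x₀ (∨I₂ hyp₀))))
          (∃E hyp₀ (∨E hyp₀ (∨I₁ hyp₀) (∨I₂ (∃I-x₀ hyp₀))))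

Δ₀⇒Π₁≅Π₁ : ∀ {n} {D A : Fm n} → IsΔ₀ D → IsΠ 1 A → EquivalentIn (IsΠ 1) (D ⇒ A)
Δ₀⇒Π₁≅Π₁ d (base p) = equivalentIn-self (base (⇒-Δ₀ d p))
Δ₀⇒Π₁≅Π₁ {D = D} d (all {α} p) =
  equivalentIn-⇔ (∀-pull-⇒ʳ D α) (∀-equivalentIn (Δ₀⇒Π₁≅Π₁ (renF-Δ₀ suc d) p))

Δ₀∧Π₁≅Π₁ : ∀ {n} {A B : Fm n} → IsΔ₀ A → IsΠ 1 B → EquivalentIn (IsΠ 1) (A ∧' B)
Δ₀∧Π₁≅Π₁ p (base q) = equivalentIn-self (base (∧-Δ₀ p q))
Δ₀∧Π₁≅Π₁ {A = A} p (all {β} q) =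
  equivalentIn-⇔ (∀-pull-∧ʳ A β) (∀-equivalentIn (Δ₀∧Π₁≅Π₁ (renF-Δ₀ suc p) q))

Π₁∧Π₁≅Π₁ : ∀ {n} {A B : Fm n} → IsΠ 1 A → IsΠ 1 B → EquivalentIn (IsΠ 1) (A ∧' B)
Π₁∧Π₁≅Π₁ (base p) q = Δ₀∧Π₁≅Π₁ p q
Π₁∧Π₁≅Π₁ {B = B} (all {α} p) q =
  equivalentIn-⇔ (∀-pull-∧ˡ α B) (∀-equivalentIn (Π₁∧Π₁≅Π₁ p (renF-Π 1 suc q)))

≅Π₁-∧ : ∀ {n} {A B : Fm n} →
        EquivalentIn (IsΠ 1) A → EquivalentIn (IsΠ 1) B → EquivalentIn (IsΠ 1) (A ∧' B)
≅Π₁-∧ (_ , a , e) (_ , b , f) = equivalentIn-⇔ (∧-cong e f) (Π₁∧Π₁≅Π₁ a b)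

choice : ∀ {n} → Fm n → Fm n → Fm (suc n)
choice A B = ((var zero ≐ 𝟎) ⇒ wkF A) ∧' (((var zero ≐ S 𝟎) ⇒ wkF B) ∧' ((var zero ≐ 𝟎) ∨' (var zero ≐ S 𝟎)))

∨⇔∃-choice : ∀ {n} (A B : Fm n) → HA⊢ ((A ∨' B) ⇔ ∃' (choice A B))
∨⇔∃-choice A B =
  ⇔-intro (∨E hyp₀
            (∃I 𝟎 (∧I (⇒I (cast (sym (wkF-[] A 𝟎)) hyp₁))
                      (∧I (⇒I (⊥E (0≢1 hyp₀))) (∨I₁ (≐refl 𝟎)))))
            (∃I (S 𝟎) (∧I (⇒I (⊥E (⇒E (S≢0 𝟎) hyp₀)))
                          (∧I (⇒I (cast (sym (wkF-[] B (S 𝟎))) hyp₁)) (∨I₂ (≐refl (S 𝟎)))))))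
          (∃E hyp₀ (∨E (∧E₂ (∧E₂ hyp₀))
                       (∨I₁ (⇒E (∧E₁ hyp₁) hyp₀))
                       (∨I₂ (⇒E (∧E₁ (∧E₂ hyp₁)) hyp₀))))

Π₁∨Π₁≅Σ₂ : ∀ {n} {A B : Fm n} → IsΠ 1 A → IsΠ 1 B → EquivalentIn (IsΣ 2) (A ∨' B)
Π₁∨Π₁≅Σ₂ {A = A} {B} p q =
  equivalentIn-⇔ (∨⇔∃-choice A B) (∃-equivalentIn (equivalentIn-mono base
    (≅Π₁-∧ (Δ₀⇒Π₁≅Π₁ (≐-Δ₀ _ _) (renF-Π 1 suc p))
    (≅Π₁-∧ (Δ₀⇒Π₁≅Π₁ (≐-Δ₀ _ _) (renF-Π 1 suc q))
           (equivalentIn-self (base (∨-Δ₀ (≐-Δ₀ _ _) (≐-Δ₀ _ _))))))))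

module _ {k : ℕ}
         (Π∨Π≅Σ⁺ : ∀ {n} {A B : Fm n} → IsΠ k A → IsΠ k B → EquivalentIn (IsΣ⁺ k) (A ∨' B))
         where

  Π∨Σ⁺≅Σ⁺ : ∀ {n} {A B : Fm n} → IsΠ k A → IsΣ⁺ k B → EquivalentIn (IsΣ⁺ k) (A ∨' B)
  Π∨Σ⁺≅Σ⁺ p (base q) = Π∨Π≅Σ⁺ p q
  Π∨Σ⁺≅Σ⁺ {A = A} p (ex {β} q) =
    equivalentIn-⇔ (∃-pull-∨ʳ A β) (∃-equivalentIn (Π∨Σ⁺≅Σ⁺ (renF-Π k suc p) q))

  Σ⁺∨Σ⁺≅Σ⁺ : ∀ {n} {A B : Fm n} → IsΣ⁺ k A → IsΣ⁺ k B → EquivalentIn (IsΣ⁺ k) (A ∨' B)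
  Σ⁺∨Σ⁺≅Σ⁺ (base p) q = Π∨Σ⁺≅Σ⁺ p q
  Σ⁺∨Σ⁺≅Σ⁺ {B = B} (ex {α} p) q =
    equivalentIn-⇔ (∃-pull-∨ˡ α B) (∃-equivalentIn (Σ⁺∨Σ⁺≅Σ⁺ p (renF-Σ⁺ k suc q)))

lemma4p1 : ∀ {n : ℕ} (φ₀ φ₁ : Fm n) → IsΣ 2 φ₀ → IsΣ 2 φ₁ →
    Σ[ φ ∈ Fm n ] (IsΣ 2 φ × HA⊢ ((φ₀ ∨' φ₁) ⇔ φ))
lemma4p1 φ₀ φ₁ = Σ⁺∨Σ⁺≅Σ⁺ Π₁∨Π₁≅Σ₂
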